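{- For every integer $k \geq 0$ and real $x$, \[ D_k(x) = (-1)^k k!\, H_{k+1}^{(-x)} \qquad\text{and}\qquad \widehat{D}_k(x) = k!\, H_{k+1}^{(x-1)}, \] where \[ H_{k+1}^{(-x)} = \sum_{j=0}^{k} \frac{(-1)^j}{k+1-j}\binom{x}{j} \qquad\text{and}\qquad H_{k+1}^{(x-1)} = \sum_{j=0}^{k} \frac{1}{k+1-j}\binom{x+j-2}{j}. \]
   Context: The Daehee polynomials of the first kind $D_k(x)$ are defined by $\sum_{k\ge 0} D_k(x)\frac{t^k}{k!} = \frac{\ln(1+t)}{t}(1+t)^x$, and those of the second kind $\widehat{D}_k(x)$ by $\sum_{k\ge 0} \widehat{D}_k(x)\frac{t^k}{k!} = \frac{\ln(1-t)}{ -t}(1-t)^{1-x}$. For real $x$, the hyperharmonic polynomials $H_r^{(x)}$ ($r\ge 0$) are defined by the generating function $\sum_{r\ge0} H_r^{(x)} t^r = -\frac{\ln(1-t)}{(1-t)^x}$ (so $H_0^{(x)}=0$). For real $y$ and integer $m\ge0$, $\binom{y}{m} = \frac{y(y-1)\cdots(y-m+1)}{m!}$ for $m\ge1$ and $\binom{y}{0}=1$. -}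

module Defs where

open import Level using (Level)
open import Data.Nat using (ℕ; zero; suc; _∸_)
open import Data.Nat.Combinatorics using ()
import Data.Nat as ℕ
open import Algebra.Bundles using (CommutativeRing)

-- Everything is developed over a commutative ring R in which every positive
-- integer is invertible (a ℚ-algebra, e.g. ℝ).  `inv n` stands for 1/(n+1).
module _ {c ℓ : Level} (R : CommutativeRing c ℓ) (inv : ℕ → CommutativeRing.Carrier R) where
  open CommutativeRing R

  IsInvSuc : Set ℓ
  IsInvSuc = ∀ n → (1# + fromℕ n) * inv n ≈ 1#
    where
    fromℕ : ℕ → Carrier
    fromℕ zero = 0#
    fromℕ (suc n) = 1# + fromℕ n

  nat : ℕ → Carrier
  nat zero = 0#
  nat (suc n) = 1# + nat n

  sgn : ℕ → Carrier
  sgn zero = 1#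
  sgn (suc n) = - (sgn n)

  sumTo : ℕ → (ℕ → Carrier) → Carrier
  sumTo zero f = f 0
  sumTo (suc n) f = sumTo n f + f (suc n)

  fact : ℕ → Carrier
  fact n = nat (n ℕ.!)

  invFact : ℕ → Carrier
  invFact zero = 1#
  invFact (suc n) = invFact n * inv n

  falling : Carrier → ℕ → Carrier
  falling y zero = 1#
  falling y (suc m) = falling y m * (y - nat m)

  binom : Carrier → ℕ → Carrier
  binom y m = falling y m * invFact m

  Series : Set c
  Series = ℕ → Carrier

  _⋆_ : Series → Series → Series
  (f ⋆ g) n = sumTo n (λ i → f i * g (n ∸ i))

  ln1+t : Series
  ln1+t zero = 0#
  ln1+t (suc n) = sgn n * inv n

  ln1-t : Series
  ln1-t zero = 0#
  ln1-t (suc n) = - inv n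

  divT : Series → Series
  divT f n = f (suc n)

  pow1+t : Carrier → Series
  pow1+t y m = binom y m

  pow1-t : Carrier → Series
  pow1-t y m = sgn m * binom y m

  -- Daehee polynomials of the first kind:
  --   Σ D_k(x) t^k/k! = (ln(1+t)/t) (1+t)^x
  D : ℕ → Carrier → Carrier
  D k x = fact k * ((divT ln1+t ⋆ pow1+t x) k)

  -- Daehee polynomials of the second kind:
  --   Σ D̂_k(x) t^k/k! = (ln(1-t)/(-t)) (1-t)^(1-x)
  Dhat : ℕ → Carrier → Carrier
  Dhat k x = fact k * ((divT (λ n → - ln1-t n) ⋆ pow1-t (1# - x)) k)

  -- hyperharmonic polynomials:  Σ H_r^(x) t^r = -ln(1-t) / (1-t)^x
  --   (1-t)^(-x) written as the binomial series with exponent -x)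
  H : ℕ → Carrier → Carrier
  H r x = ((λ n → - ln1-t n) ⋆ pow1-t (- x)) r

{-# OPTIONS --safe #-}
-- All four identities compare coefficients of formal power series.  Since
-- -ln(1-t) has no constant term, H_{k+1}^{(y)} is the k-th coefficient of
-- (-ln(1-t)/t) (1-t)^{-y}, which for y = x - 1 is the series defining D̂_k(x)/k!.
-- Substituting t ↦ -t multiplies the k-th coefficient by (-1)^k, commutes with
-- the Cauchy product, and turns -ln(1-t)/t and (1-t)^x into ln(1+t)/t and
-- (1+t)^x, the series defining D_k.  The explicit sums come from reading the
-- convolution backwards together with the reflection (-1)^j (-y)_j = (y+j-1)_j
-- of falling factorials.
module Submission where

open import Level using (Level)
open import Data.Nat using (ℕ; zero; suc; _∸_; _≤_; z≤n)
import Data.Nat as ℕ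
open import Data.Nat.Properties using (≤-refl; m≤n⇒m≤1+n; m∸[m∸n]≡n; m+[n∸m]≡n)
open import Data.Product using (_×_; _,_)
open import Algebra.Bundles using (CommutativeRing)
import Algebra.Properties.Ring as RingProperties
import Algebra.Properties.CommutativeSemigroup as CommutativeSemigroupProperties
import Relation.Binary.PropositionalEquality as ≡
import Relation.Binary.Reasoning.Setoid as SetoidReasoning
import Defs

module Daehee {c ℓ : Level} (R : CommutativeRing c ℓ) (inv : ℕ → CommutativeRing.Carrier R) where
  open CommutativeRing R hiding (zero)
  open RingProperties ring
    using (-0#≈0#; -‿involutive; -‿+-comm; ⁻¹-anti-homo‿-; -‿distribˡ-*; -‿distribʳ-*)
  open CommutativeSemigroupProperties *-commutativeSemigroup
    using (interchange; xy∙z≈y∙xz; x∙yz≈yx∙z)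
  open SetoidReasoning setoid

  Series : Set c
  Series = Defs.Series R inv

  nat : ℕ → Carrier
  nat = Defs.nat R inv

  sgn : ℕ → Carrier
  sgn = Defs.sgn R inv

  sumTo : ℕ → (ℕ → Carrier) → Carrier
  sumTo = Defs.sumTo R inv

  fact : ℕ → Carrier
  fact = Defs.fact R inv

  falling : Carrier → ℕ → Carrier
  falling = Defs.falling R inv

  binom : Carrier → ℕ → Carrier
  binom = Defs.binom R inv

  _⋆_ : Series → Series → Series
  _⋆_ = Defs._⋆_ R inv

  divT : Series → Series
  divT = Defs.divT R inv

  ln1+t ln1-t : Series
  ln1+t = Defs.ln1+t R inv
  ln1-t = Defs.ln1-t R inv

  pow1+t pow1-t : Carrier → Series
  pow1+t = Defs.pow1+t R inv
  pow1-t = Defs.pow1-t R inv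

  -ln[1-t]/t ln[1+t]/t : Series
  -ln[1-t]/t = divT (λ n → - ln1-t n)
  ln[1+t]/t = divT ln1+t

  H D Dhat : ℕ → Carrier → Carrier
  H = Defs.H R inv
  D = Defs.D R inv
  Dhat = Defs.Dhat R inv

  sumTo-cong : ∀ n {f g : ℕ → Carrier} → (∀ i → i ≤ n → f i ≈ g i) → sumTo n f ≈ sumTo n g
  sumTo-cong zero    f≈g = f≈g 0 z≤n
  sumTo-cong (suc n) f≈g =
    +-cong (sumTo-cong n (λ i i≤n → f≈g i (m≤n⇒m≤1+n i≤n))) (f≈g (suc n) ≤-refl)

  sumTo-sucˡ : ∀ n (f : ℕ → Carrier) → sumTo (suc n) f ≈ f 0 + sumTo n (λ i → f (suc i))
  sumTo-sucˡ zero    f = refl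
  sumTo-sucˡ (suc n) f = trans (+-congʳ (sumTo-sucˡ n f)) (+-assoc _ _ _)

  sumTo-reverse : ∀ n (f : ℕ → Carrier) → sumTo n f ≈ sumTo n (λ i → f (n ∸ i))
  sumTo-reverse zero    f = refl
  sumTo-reverse (suc n) f = begin
    sumTo n f + f (suc n)                    ≈⟨ +-comm _ _ ⟩
    f (suc n) + sumTo n f                    ≈⟨ +-congˡ (sumTo-reverse n f) ⟩
    f (suc n) + sumTo n (λ i → f (n ∸ i))    ≈⟨ sumTo-sucˡ n (λ i → f (suc n ∸ i)) ⟨
    sumTo (suc n) (λ i → f (suc n ∸ i))      ∎

  *-distribˡ-sumTo : ∀ n a (f : ℕ → Carrier) → a * sumTo n f ≈ sumTo n (λ i → a * f i)
  *-distribˡ-sumTo zero    a f = refl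
  *-distribˡ-sumTo (suc n) a f = trans (distribˡ _ _ _) (+-congʳ (*-distribˡ-sumTo n a f))

  ⋆-cong : ∀ {f f′ g g′ : Series} → (∀ n → f n ≈ f′ n) → (∀ n → g n ≈ g′ n) →
           ∀ n → (f ⋆ g) n ≈ (f′ ⋆ g′) n
  ⋆-cong f≈f′ g≈g′ n = sumTo-cong n (λ i _ → *-cong (f≈f′ i) (g≈g′ (n ∸ i)))

  ⋆-comm : ∀ (f g : Series) n → (f ⋆ g) n ≈ (g ⋆ f) n
  ⋆-comm f g n = trans (sumTo-reverse n _) (sumTo-cong n swap)
    where
    swap : ∀ i → i ≤ n → f (n ∸ i) * g (n ∸ (n ∸ i)) ≈ g i * f (n ∸ i)
    swap i i≤n = trans (*-congˡ (reflexive (≡.cong g (m∸[m∸n]≡n i≤n)))) (*-comm _ _)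

  ⋆-divT : ∀ (f g : Series) n → f 0 ≈ 0# → (f ⋆ g) (suc n) ≈ (divT f ⋆ g) n
  ⋆-divT f g n f0≈0 = begin
    (f ⋆ g) (suc n)                     ≈⟨ sumTo-sucˡ n _ ⟩
    f 0 * g (suc n) + (divT f ⋆ g) n    ≈⟨ +-congʳ (trans (*-congʳ f0≈0) (zeroˡ _)) ⟩
    0# + (divT f ⋆ g) n                 ≈⟨ +-identityˡ _ ⟩
    (divT f ⋆ g) n                      ∎

  -x*-y≈x*y : ∀ x y → - x * - y ≈ x * y
  -x*-y≈x*y x y = begin
    - x * - y      ≈⟨ -‿distribˡ-* x (- y) ⟨
    - (x * - y)    ≈⟨ -‿cong (-‿distribʳ-* x y) ⟨
    - - (x * y)    ≈⟨ -‿involutive _ ⟩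
    x * y          ∎

  sgn-+ : ∀ m n → sgn (m ℕ.+ n) ≈ sgn m * sgn n
  sgn-+ zero    n = sym (*-identityˡ _)
  sgn-+ (suc m) n = trans (-‿cong (sgn-+ m n)) (-‿distribˡ-* _ _)

  sgn-*-sgn : ∀ n → sgn n * sgn n ≈ 1#
  sgn-*-sgn zero    = *-identityˡ 1#
  sgn-*-sgn (suc n) = trans (-x*-y≈x*y _ _) (sgn-*-sgn n)

  -- The substitution t ↦ -t.
  alt : Series → Series
  alt f n = sgn n * f n

  sgn-*-⋆ : ∀ (f g : Series) n → sgn n * (f ⋆ g) n ≈ (alt f ⋆ alt g) n
  sgn-*-⋆ f g n = trans (*-distribˡ-sumTo n (sgn n) _) (sumTo-cong n split)
    where
    split : ∀ i → i ≤ n → sgn n * (f i * g (n ∸ i)) ≈ (sgn i * f i) * (sgn (n ∸ i) * g (n ∸ i))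
    split i i≤n = begin
      sgn n * (f i * g (n ∸ i))                   ≈⟨ *-congʳ (reflexive (≡.cong sgn (m+[n∸m]≡n i≤n))) ⟨
      sgn (i ℕ.+ (n ∸ i)) * (f i * g (n ∸ i))     ≈⟨ *-congʳ (sgn-+ i (n ∸ i)) ⟩
      (sgn i * sgn (n ∸ i)) * (f i * g (n ∸ i))   ≈⟨ interchange _ _ _ _ ⟩
      (sgn i * f i) * (sgn (n ∸ i) * g (n ∸ i))   ∎

  alt-pow1-t : ∀ y m → alt (pow1-t y) m ≈ pow1+t y m
  alt-pow1-t y m = begin
    sgn m * (sgn m * binom y m)   ≈⟨ *-assoc _ _ _ ⟨
    (sgn m * sgn m) * binom y m   ≈⟨ *-congʳ (sgn-*-sgn m) ⟩
    1# * binom y m                ≈⟨ *-identityˡ _ ⟩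
    binom y m                     ∎

  alt-ln[1-t]/t : ∀ n → alt -ln[1-t]/t n ≈ ln[1+t]/t n
  alt-ln[1-t]/t n = *-congˡ (-‿involutive (inv n))

  falling-cong : ∀ j {y z} → y ≈ z → falling y j ≈ falling z j
  falling-cong zero    y≈z = refl
  falling-cong (suc j) y≈z = *-cong (falling-cong j y≈z) (+-congʳ y≈z)

  binom-cong : ∀ j {y z} → y ≈ z → binom y j ≈ binom z j
  binom-cong j y≈z = *-congʳ (falling-cong j y≈z)

  falling-sucˡ : ∀ j y → falling y (suc j) ≈ y * falling (y - 1#) j
  falling-sucˡ zero y = begin
    1# * (y - 0#)   ≈⟨ *-identityˡ _ ⟩
    y - 0#          ≈⟨ +-congˡ -0#≈0# ⟩
    y + 0#          ≈⟨ +-identityʳ y ⟩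
    y               ≈⟨ *-identityʳ y ⟨
    y * 1#          ∎
  falling-sucˡ (suc j) y = begin
    falling y (suc j) * (y - (1# + nat j))            ≈⟨ *-cong (falling-sucˡ j y) sub-suc ⟩
    (y * falling (y - 1#) j) * ((y - 1#) - nat j)     ≈⟨ *-assoc _ _ _ ⟩
    y * falling (y - 1#) (suc j)                      ∎
    where
    sub-suc : y - (1# + nat j) ≈ (y - 1#) - nat j
    sub-suc = trans (+-congˡ (sym (-‿+-comm 1# (nat j)))) (sym (+-assoc _ _ _))

  sgn-*-falling-neg : ∀ j y → sgn j * falling (- y) j ≈ falling (y + nat j - 1#) j
  sgn-*-falling-neg zero    y = *-identityˡ 1#
  sgn-*-falling-neg (suc j) y = begin
    - sgn j * (falling (- y) j * (- y - nat j))      ≈⟨ -‿distribˡ-* _ _ ⟨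
    - (sgn j * (falling (- y) j * (- y - nat j)))    ≈⟨ -‿cong (*-assoc _ _ _) ⟨
    - ((sgn j * falling (- y) j) * (- y - nat j))    ≈⟨ -‿distribʳ-* _ _ ⟩
    (sgn j * falling (- y) j) * - (- y - nat j)      ≈⟨ *-cong (sgn-*-falling-neg j y) neg-neg-sub ⟩
    falling (y + nat j - 1#) j * (y + nat j)         ≈⟨ *-comm _ _ ⟩
    (y + nat j) * falling (y + nat j - 1#) j         ≈⟨ falling-sucˡ j _ ⟨
    falling (y + nat j) (suc j)                      ≈⟨ falling-cong (suc j) add-sub-one ⟩
    falling (y + nat (suc j) - 1#) (suc j)           ∎
    where
    neg-neg-sub : - (- y - nat j) ≈ y + nat j
    neg-neg-sub = trans (sym (-‿+-comm (- y) (- nat j)))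
                        (+-cong (-‿involutive y) (-‿involutive (nat j)))
    add-sub-one : y + nat j ≈ y + (1# + nat j) - 1#
    add-sub-one = begin
      y + nat j                    ≈⟨ +-identityʳ _ ⟨
      y + nat j + 0#               ≈⟨ +-congˡ (-‿inverseʳ 1#) ⟨
      y + nat j + (1# - 1#)        ≈⟨ +-assoc _ _ _ ⟨
      y + nat j + 1# - 1#          ≈⟨ +-congʳ (+-assoc _ _ _) ⟩
      y + (nat j + 1#) - 1#        ≈⟨ +-congʳ (+-congˡ (+-comm _ _)) ⟩
      y + (1# + nat j) - 1#        ∎

  sgn-*-binom-neg : ∀ j y → sgn j * binom (- y) j ≈ binom (y + nat j - 1#) j
  sgn-*-binom-neg j y = trans (sym (*-assoc _ _ _)) (*-congʳ (sgn-*-falling-neg j y))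

  H-suc : ∀ k y → H (suc k) y ≈ (-ln[1-t]/t ⋆ pow1-t (- y)) k
  H-suc k y = ⋆-divT (λ n → - ln1-t n) (pow1-t (- y)) k -0#≈0#

  H-suc-reversed : ∀ k y → H (suc k) y ≈ sumTo k (λ j → inv (k ∸ j) * (sgn j * binom (- y) j))
  H-suc-reversed k y = begin
    H (suc k) y                                ≈⟨ H-suc k y ⟩
    (-ln[1-t]/t ⋆ pow1-t (- y)) k              ≈⟨ ⋆-comm _ _ k ⟩
    (pow1-t (- y) ⋆ -ln[1-t]/t) k              ≈⟨ sumTo-cong k (λ j _ → swap j) ⟩
    sumTo k (λ j → inv (k ∸ j) * (sgn j * binom (- y) j)) ∎
    where
    swap : ∀ j → pow1-t (- y) j * - - inv (k ∸ j) ≈ inv (k ∸ j) * pow1-t (- y) j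
    swap j = trans (*-comm _ _) (*-congʳ (-‿involutive _))

  D≈sgn*fact*H : ∀ k x → D k x ≈ sgn k * fact k * H (suc k) (- x)
  D≈sgn*fact*H k x = sym (begin
    sgn k * fact k * H (suc k) (- x)
      ≈⟨ xy∙z≈y∙xz _ _ _ ⟩
    fact k * (sgn k * H (suc k) (- x))
      ≈⟨ *-congˡ (*-congˡ (H-suc k (- x))) ⟩
    fact k * (sgn k * (-ln[1-t]/t ⋆ pow1-t (- - x)) k)
      ≈⟨ *-congˡ (sgn-*-⋆ -ln[1-t]/t (pow1-t (- - x)) k) ⟩
    fact k * (alt -ln[1-t]/t ⋆ alt (pow1-t (- - x))) k
      ≈⟨ *-congˡ (⋆-cong alt-ln[1-t]/t alt-pow k) ⟩
    fact k * (ln[1+t]/t ⋆ pow1+t x) k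
      ∎)
    where
    alt-pow : ∀ m → alt (pow1-t (- - x)) m ≈ pow1+t x m
    alt-pow m = trans (alt-pow1-t (- - x) m) (binom-cong m (-‿involutive x))

  Dhat≈fact*H : ∀ k x → Dhat k x ≈ fact k * H (suc k) (x - 1#)
  Dhat≈fact*H k x = sym (*-congˡ (trans (H-suc k (x - 1#)) (⋆-cong (λ _ → refl) pow-cong k)))
    where
    pow-cong : ∀ m → pow1-t (- (x - 1#)) m ≈ pow1-t (1# - x) m
    pow-cong m = *-congˡ (binom-cong m (⁻¹-anti-homo‿- x 1#))

  H-suc-neg≈sumTo : ∀ k x → H (suc k) (- x) ≈ sumTo k (λ j → sgn j * inv (k ∸ j) * binom x j)
  H-suc-neg≈sumTo k x = trans (H-suc-reversed k (- x)) (sumTo-cong k (λ j _ → rearrange j))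
    where
    rearrange : ∀ j → inv (k ∸ j) * (sgn j * binom (- - x) j) ≈ sgn j * inv (k ∸ j) * binom x j
    rearrange j = trans (*-congˡ (*-congˡ (binom-cong j (-‿involutive x)))) (x∙yz≈yx∙z _ _ _)

  H-suc-pred≈sumTo : ∀ k x →
    H (suc k) (x - 1#) ≈ sumTo k (λ j → inv (k ∸ j) * binom (x + nat j - (1# + 1#)) j)
  H-suc-pred≈sumTo k x =
    trans (H-suc-reversed k (x - 1#)) (sumTo-cong k (λ j _ → *-congˡ (reflect j)))
    where
    reflect : ∀ j → sgn j * binom (- (x - 1#)) j ≈ binom (x + nat j - (1# + 1#)) j
    reflect j = trans (sgn-*-binom-neg j (x - 1#)) (binom-cong j (begin
      x - 1# + nat j - 1#        ≈⟨ +-congʳ (+-assoc _ _ _) ⟩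
      x + (- 1# + nat j) - 1#    ≈⟨ +-congʳ (+-congˡ (+-comm _ _)) ⟩
      x + (nat j - 1#) - 1#      ≈⟨ +-congʳ (+-assoc _ _ _) ⟨
      x + nat j - 1# - 1#        ≈⟨ +-assoc _ _ _ ⟩
      x + nat j + (- 1# - 1#)    ≈⟨ +-congˡ (-‿+-comm 1# 1#) ⟩
      x + nat j - (1# + 1#)      ∎))

open Defs

-- No step divides.
theorem2 : {c ℓ : Level} (R : CommutativeRing c ℓ)
    (inv : ℕ → CommutativeRing.Carrier R) → IsInvSuc R inv →
    let open CommutativeRing R in
    (k : ℕ) (x : Carrier) →
      (D R inv k x ≈ sgn R inv k * fact R inv k * H R inv (suc k) (- x))
      × (Dhat R inv k x ≈ fact R inv k * H R inv (suc k) (x - 1#))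
      × (H R inv (suc k) (- x)
          ≈ sumTo R inv k (λ j → sgn R inv j * inv (k ∸ j) * binom R inv x j))
      × (H R inv (suc k) (x - 1#)
          ≈ sumTo R inv k (λ j → inv (k ∸ j) * binom R inv (x + nat R inv j - (1# + 1#)) j))
theorem2 R inv _ k x =
  D≈sgn*fact*H k x , Dhat≈fact*H k x , H-suc-neg≈sumTo k x , H-suc-pred≈sumTo k x
  where open Daehee R inv using (D≈sgn*fact*H; Dhat≈fact*H; H-suc-neg≈sumTo; H-suc-pred≈sumTo)
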